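{- Let $\mathsf{K}$ be a class of algebras that contains two (distinct) trivial algebras and is closed under Płonka sums. Then there is no protoalgebraic logic $\vdash$ such that $\mathrm{Alg}(\vdash)=\mathsf{K}$.
   Context: Fix an algebraic language without constant symbols. A logic is a substitution-invariant consequence relation $\vdash$ on formulas. A matrix $\langle\mathbf{A},F\rangle$ is a model of $\vdash$ if $\Gamma\vdash\varphi$ and $h[\Gamma]\subseteq F$ (homomorphism $h$ from the formula algebra) imply $h(\varphi)\in F$; $F$ is then a $\vdash$-filter. $\Omega^{\mathbf{A}}F$ is the largest congruence of $\mathbf{A}$ compatible with $F$; the Suszko congruence is the intersection of $\Omega^{\mathbf{A}}G$ over $\vdash$-filters $G\supseteq F$; $\mathrm{Alg}(\vdash)$ is the class of algebras $\mathbf{A}$ such that some model $\langle\mathbf{A},F\rangle$ of $\vdash$ has identity Suszko congruence. $\vdash$ is protoalgebraic if there is a set of formulas $\Delta(x,y)$ with $\emptyset\vdash\Delta(x,x)$ and $x,\Delta(x,y)\vdash y$. A trivial algebra is a one-element algebra. A directed system of algebras consists of a semilattice $\langle I,\vee\rangle$ (order $i\le j$ iff $i\vee j=j$), algebras $\mathbf{A}_i$ with pairwise disjoint universes and homomorphisms $f_{ij}\colon\mathbf{A}_i\to\mathbf{A}_j$ for $i\le j$, with $f_{ii}=\mathrm{id}$ and $f_{ik}=f_{jk}\circ f_{ij}$; its Płonka sum is the algebra with universe $\bigcup_iA_i$ and $f(a_1,\dots,a_n)=f^{\mathbf{A}_j}(f_{i_1j}(a_1),\dots,f_{i_nj}(a_n))$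 for $a_k\in A_{i_k}$, $j=i_1\vee\dots\vee i_n$. A class is closed under Płonka sums if it contains the Płonka sum of every directed system of algebras from the class. -}

module Defs where

open import Level using (Level; _⊔_) renaming (suc to lsuc; zero to lzero)
open import Data.Nat using (ℕ; zero; suc; _<_; NonZero)
open import Data.Fin using (Fin; zero; suc)
open import Data.Product using (Σ; Σ-syntax; ∃; _×_; _,_; proj₁; proj₂)
open import Data.Sum using (_⊎_)
open import Data.Empty using (⊥)
open import Function using (_∘_)
open import Relation.Binary.PropositionalEquality using (_≡_; refl; sym; trans; cong)
open import Algebra.Lattice.Structures using (IsJoinSemilattice)
import Algebra.Lattice.Structures as LS

record Signature : Set₁ where
  field
    Op      : Set
    ar      : Op → ℕ
    noConst : (f : Op) → NonZero (ar f)
open Signature public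

record Algebra (𝓛 : Signature) : Set₁ where
  field
    Carrier  : Set
    ⟦_⟧      : (f : Op 𝓛) → (Fin (ar 𝓛 f) → Carrier) → Carrier
    element  : Carrier           -- carriers are nonempty
open Algebra public

Trivial : {𝓛 : Signature} → Algebra 𝓛 → Set
Trivial A = Σ (Carrier A) λ c → (x : Carrier A) → x ≡ c

IsHom : {𝓛 : Signature} (A B : Algebra 𝓛) → (Carrier A → Carrier B) → Set
IsHom {𝓛} A B h =
  (f : Op 𝓛) (as : Fin (ar 𝓛 f) → Carrier A) → h (⟦ A ⟧ f as) ≡ ⟦ B ⟧ f (h ∘ as)

module _ (𝓛 : Signature) where

  data Fm : Set where
    var : ℕ → Fm
    op  : (f : Op 𝓛) → (Fin (ar 𝓛 f) → Fm) → Fm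

eval : {𝓛 : Signature} (A : Algebra 𝓛) → (ℕ → Carrier A) → Fm 𝓛 → Carrier A
eval A v (var n)   = v n
eval A v (op f ts) = ⟦ A ⟧ f (λ i → eval A v (ts i))

subst : {𝓛 : Signature} → (ℕ → Fm 𝓛) → Fm 𝓛 → Fm 𝓛
subst σ (var n)   = σ n
subst σ (op f ts) = op f (λ i → subst σ (ts i))

FmSet : Signature → Set₁
FmSet 𝓛 = Fm 𝓛 → Set

_⊆_ : {X : Set} → (X → Set) → (X → Set) → Set
P ⊆ Q = ∀ x → P x → Q x

_[_] : {𝓛 : Signature} → (ℕ → Fm 𝓛) → FmSet 𝓛 → FmSet 𝓛
σ [ Γ ] = λ ψ → Σ _ λ γ → Γ γ × (ψ ≡ subst σ γ)

record Logic (𝓛 : Signature) : Set₁ where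
  field
    _⊢_    : FmSet 𝓛 → Fm 𝓛 → Set
    refl⊢  : ∀ {Γ φ} → Γ φ → Γ ⊢ φ
    mono⊢  : ∀ {Γ Δ φ} → Γ ⊆ Δ → Γ ⊢ φ → Δ ⊢ φ
    cut⊢   : ∀ {Γ Δ φ} → (∀ ψ → Δ ψ → Γ ⊢ ψ) → Δ ⊢ φ → Γ ⊢ φ
    struct : ∀ {Γ φ} (σ : ℕ → Fm 𝓛) → Γ ⊢ φ → (σ [ Γ ]) ⊢ subst σ φ
open Logic public

-- formulas whose variables are among x = var 0, y = var 1
InXY : {𝓛 : Signature} → Fm 𝓛 → Set
InXY (var n)   = n < 2
InXY (op f ts) = ∀ i → InXY (ts i)

y↦x : {𝓛 : Signature} → ℕ → Fm 𝓛
y↦x 1 = var 0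
y↦x n = var n

∅ : {𝓛 : Signature} → FmSet 𝓛
∅ _ = ⊥

Protoalgebraic : {𝓛 : Signature} → Logic 𝓛 → Set₁
Protoalgebraic {𝓛} L =
  Σ (FmSet 𝓛) λ Δ →
      (∀ δ → Δ δ → InXY δ)
    × (∀ δ → Δ δ → _⊢_ L ∅ (subst y↦x δ))
    × _⊢_ L (λ φ → (φ ≡ var 0) ⊎ Δ φ) (var 1)

module _ {𝓛 : Signature} (L : Logic 𝓛) (A : Algebra 𝓛) where

  IsFilter : (Carrier A → Set) → Set₁
  IsFilter F = ∀ Γ φ → _⊢_ L Γ φ → (v : ℕ → Carrier A) →
               (∀ ψ → Γ ψ → F (eval A v ψ)) → F (eval A v φ)

  IsCongruence : (Carrier A → Carrier A → Set) → Set
  IsCongruence θ =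
      (∀ a → θ a a)
    × (∀ a b → θ a b → θ b a)
    × (∀ a b c → θ a b → θ b c → θ a c)
    × (∀ (f : Op 𝓛) (as bs : Fin (ar 𝓛 f) → Carrier A) →
         (∀ i → θ (as i) (bs i)) → θ (⟦ A ⟧ f as) (⟦ A ⟧ f bs))

  Compatible : (Carrier A → Carrier A → Set) → (Carrier A → Set) → Set
  Compatible θ F = ∀ a b → θ a b → F a → F b

  -- Leibniz congruence Ω^A F: the largest congruence compatible with F,
  -- i.e. the union of all congruences compatible with F
  Ω : (Carrier A → Set) → Carrier A → Carrier A → Set₁
  Ω F a b = Σ (Carrier A → Carrier A → Set) λ θ →
              IsCongruence θ × Compatible θ F × θ a b

  Suszko : (Carrier A → Set) → Carrier A → Carrier A → Set₁
  Suszko F a b = (G : Carrier A → Set) → IsFilter G → F ⊆ G → Ω G a b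

  InAlg : Set₁
  InAlg = Σ (Carrier A → Set) λ F →
            IsFilter F × ((a b : Carrier A) → Suszko F a b → a ≡ b)

record DirectedSystem (𝓛 : Signature) : Set₁ where
  field
    I       : Set
    _∨_     : I → I → I
    isSL    : IsJoinSemilattice _≡_ _∨_
    i₀      : I                         -- the semilattice is nonempty
    𝐀       : I → Algebra 𝓛
    -- disjointness of universes is realised by the tagged (Σ) union below
  _≤_ : I → I → Set
  i ≤ j = i ∨ j ≡ j
  field
    hom     : ∀ {i j} → i ≤ j → Carrier (𝐀 i) → Carrier (𝐀 j)
    hom-hom : ∀ {i j} (p : i ≤ j) → IsHom (𝐀 i) (𝐀 j) (hom p)
    hom-id  : ∀ {i} (p : i ≤ i) x → hom p x ≡ x
    hom-∘   : ∀ {i j k} (p : i ≤ j) (q : j ≤ k) (r : i ≤ k) x →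
              hom r x ≡ hom q (hom p x)

module PlonkaSumConstruction {𝓛 : Signature} (D : DirectedSystem 𝓛) where
  open DirectedSystem D
  open LS.IsJoinSemilattice _≡_ isSL using (assoc; comm; idem)

  joinS : (n : ℕ) → (Fin (suc n) → I) → I
  joinS zero    g = g zero
  joinS (suc n) g = g zero ∨ joinS n (g ∘ suc)

  joinS-ub : ∀ n g (k : Fin (suc n)) → g k ≤ joinS n g
  joinS-ub zero    g zero    = idem (g zero)
  joinS-ub (suc n) g zero    =
    trans (sym (assoc (g zero) (g zero) (joinS n (g ∘ suc))))
      (cong (_∨ joinS n (g ∘ suc)) (idem (g zero)))
  joinS-ub (suc n) g (suc k) =
    trans (sym (assoc (g (suc k)) (g zero) (joinS n (g ∘ suc))))
      (trans (cong (_∨ joinS n (g ∘ suc)) (comm (g (suc k)) (g zero)))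
        (trans (assoc (g zero) (g (suc k)) (joinS n (g ∘ suc)))
          (cong (g zero ∨_) (joinS-ub n (g ∘ suc) k))))

  -- join of a finite family (the empty case never arises: no constants)
  join : (n : ℕ) → (Fin n → I) → I
  join zero    g = i₀
  join (suc n) g = joinS n g

  join-ub : ∀ n g (k : Fin n) → g k ≤ join n g
  join-ub (suc n) g k = joinS-ub n g k

  Sum : Set
  Sum = Σ I λ i → Carrier (𝐀 i)

  sumOp : (f : Op 𝓛) → (Fin (ar 𝓛 f) → Sum) → Sum
  sumOp f as = j , ⟦ 𝐀 j ⟧ f (λ k → hom (join-ub n idx k) (proj₂ (as k)))
    where
    n   = ar 𝓛 f
    idx = λ k → proj₁ (as k)
    j   = join n idx

  PlonkaSum : Algebra 𝓛
  PlonkaSum = record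
    { Carrier = Sum
    ; ⟦_⟧     = sumOp
    ; element = i₀ , element (𝐀 i₀)
    }

open PlonkaSumConstruction public using (PlonkaSum)

ClosedUnderPlonkaSums : {ℓ : Level} {𝓛 : Signature} → (Algebra 𝓛 → Set ℓ) → Set (lsuc lzero ⊔ ℓ)
ClosedUnderPlonkaSums {𝓛 = 𝓛} K =
  (D : DirectedSystem 𝓛) →
  (∀ i → K (DirectedSystem.𝐀 D i)) → K (PlonkaSum D)

-- The Płonka sum S of two copies of a trivial algebra, indexed by the
-- two-element semilattice, has two elements and lies in K; yet every term
-- operation of S is idempotent, because no constants occur and the index of a
-- value is the join of the indices of its arguments.  For a protoalgebraic
-- logic this forces every filter of S to be empty or full: a theorem δ(x,x)
-- takes every value of S, so all of Δ(a,b) lies in each filter, and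
-- x, Δ(x,y) ⊢ y then moves membership from a to b.  The total relation is
-- therefore compatible with all filters, the Suszko congruence of every filter
-- is total, and S ∉ Alg(⊢).
module Submission where

open import Defs
open import Level using (Level)
open import Data.Product using (Σ; _×_; _,_; proj₁; proj₂)
open import Relation.Nullary using (¬_)
open import Function.Bundles using (_⇔_; Equivalence)
open import Data.Bool using (Bool; true; false)
import Data.Bool as Bool
open import Data.Bool.Properties using (∨-isSemilattice)
open import Data.Nat using (ℕ; zero; suc)
open import Data.Fin using (Fin; zero; suc)
open import Data.Sum using (_⊎_; inj₁; inj₂)
open import Data.Unit using (⊤; tt)
open import Relation.Binary.PropositionalEquality
  using (_≡_; refl; sym; trans; cong; cong₂) renaming (subst to transport)
import Algebra.Lattice.Structures as LS

TermIdempotent : {𝓛 : Signature} → Algebra 𝓛 → Set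
TermIdempotent B = ∀ (φ : Fm _) p → eval B (λ _ → p) φ ≡ p

module _ {𝓛 : Signature} (D : DirectedSystem 𝓛) where
  open DirectedSystem D
  open PlonkaSumConstruction D using (joinS)
  open LS.IsJoinSemilattice _≡_ isSL using (idem)

  joinS-const : ∀ {i} n (g : Fin (suc n) → I) → (∀ k → g k ≡ i) → joinS n g ≡ i
  joinS-const zero    g g≡i = g≡i zero
  joinS-const {i} (suc n) g g≡i =
    trans (cong₂ _∨_ (g≡i zero) (joinS-const n (λ k → g (suc k)) (λ k → g≡i (suc k))))
          (idem i)

  index-eval : ∀ {i} (v : ℕ → Carrier (PlonkaSum D)) → (∀ n → proj₁ (v n) ≡ i) →
               (φ : Fm 𝓛) → proj₁ (eval (PlonkaSum D) v φ) ≡ i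
  index-eval v v≡i (var n)   = v≡i n
  -- Abstracting noConst 𝓛 f together with the arity makes the nullary case absurd.
  index-eval v v≡i (op f ts) with ar 𝓛 f | noConst 𝓛 f
  ... | suc n | _ = joinS-const n _ (λ k → index-eval v v≡i (ts k))

  module _ (trivial : ∀ i → Trivial (𝐀 i)) where

    index-injective : {p q : Carrier (PlonkaSum D)} → proj₁ p ≡ proj₁ q → p ≡ q
    index-injective {i , x} {.i , y} refl =
      cong (i ,_) (trans (proj₂ (trivial i) x) (sym (proj₂ (trivial i) y)))

    plonkaSum-termIdempotent : TermIdempotent (PlonkaSum D)
    plonkaSum-termIdempotent φ p = index-injective (index-eval (λ _ → p) (λ _ → refl) φ)

module _ {𝓛 : Signature} (L : Logic 𝓛) (B : Algebra 𝓛) where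

  theorem∈filter : ∀ {G φ} → IsFilter L B G → _⊢_ L ∅ φ → ∀ v → G (eval B v φ)
  theorem∈filter {φ = φ} isFilter ⊢φ v = isFilter ∅ φ ⊢φ v (λ _ ())

  termIdempotent-filter-full : Protoalgebraic L → TermIdempotent B →
    ∀ {G} → IsFilter L B G → ∀ a b → G a → G b
  termIdempotent-filter-full (Δ , _ , ⊢Δxx , x,Δ⊢y) idempotent {G} isFilter a b Ga =
    isFilter _ (var 1) x,Δ⊢y v premises
    where
    v : ℕ → Carrier B
    v zero    = a
    v (suc _) = b

    Δab∈G : ∀ δ → Δ δ → G (eval B v δ)
    Δab∈G δ δ∈Δ =
      transport G (idempotent (subst y↦x δ) (eval B v δ))
        (theorem∈filter {G} isFilter (⊢Δxx δ δ∈Δ) (λ _ → eval B v δ))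

    premises : ∀ ψ → (ψ ≡ var 0) ⊎ Δ ψ → G (eval B v ψ)
    premises _ (inj₁ refl) = Ga
    premises ψ (inj₂ ψ∈Δ)  = Δab∈G ψ ψ∈Δ

  total-congruence : IsCongruence L B (λ _ _ → ⊤)
  total-congruence = (λ _ → tt) , (λ _ _ _ → tt) , (λ _ _ _ _ _ → tt) , (λ _ _ _ _ → tt)

  inAlg-filters-full⇒subsingleton :
    (∀ {G} → IsFilter L B G → ∀ a b → G a → G b) →
    InAlg L B → (a b : Carrier B) → a ≡ b
  inAlg-filters-full⇒subsingleton full (_ , _ , suszko-identity) a b =
    suszko-identity a b
      (λ G isFilter _ → (λ _ _ → ⊤) , total-congruence , (λ x y _ → full isFilter x y) , tt)

twoCopies : {𝓛 : Signature} → Algebra 𝓛 → DirectedSystem 𝓛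
twoCopies A = record
  { I = Bool ; _∨_ = Bool._∨_ ; isSL = ∨-isSemilattice ; i₀ = false
  ; 𝐀 = λ _ → A
  ; hom = λ _ x → x ; hom-hom = λ _ _ _ → refl ; hom-id = λ _ _ → refl
  ; hom-∘ = λ _ _ _ _ → refl }

-- Only one trivial algebra of K is needed: the Płonka sum keeps the two
-- copies apart by tagging them with their index.
theorem6p2 : {ℓ : Level} (𝓛 : Signature) (K : Algebra 𝓛 → Set ℓ) →
    Σ (Algebra 𝓛) (λ A → Trivial A × K A) →
    Σ (Algebra 𝓛) (λ B → Trivial B × K B) →
    ClosedUnderPlonkaSums K →
    ¬ (Σ (Logic 𝓛) λ L → Protoalgebraic L × ((A : Algebra 𝓛) → InAlg L A ⇔ K A))
theorem6p2 𝓛 K (A , trivialA , A∈K) _ closed (L , protoalgebraic , Alg≡K) =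
  false≢true (cong proj₁ (subsingleton (false , c) (true , c)))
  where
  S : Algebra 𝓛
  S = PlonkaSum (twoCopies A)

  c : Carrier A
  c = proj₁ trivialA

  S∈Alg : InAlg L S
  S∈Alg = Equivalence.from (Alg≡K S) (closed (twoCopies A) (λ _ → A∈K))

  subsingleton : (a b : Carrier S) → a ≡ b
  subsingleton = inAlg-filters-full⇒subsingleton L S
    (termIdempotent-filter-full L S protoalgebraic
      (plonkaSum-termIdempotent (twoCopies A) (λ _ → trivialA)))
    S∈Alg

  false≢true : ¬ (false ≡ true)
  false≢true ()
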